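{- Let $a$ and $m$ be positive integers and $f_0(n)=\binom{n+a-2}{a-1}$ for $n=1,2,\ldots$. Then for $1\le k\le n$, \[c_m(n,k)=\sum_{i=k}^n(m-1)^{i-k}\binom{i-1}{k-1}\binom{n+ai-i-1}{ai-1},\qquad f_m(n)=\sum_{i=1}^n m^{i-1}\binom{n+ai-i-1}{ai-1}.\]
   Context: For an arithmetic function $f_0$ defined on the positive integers, define recursively for $m\ge 1$: $c_m(n,k)=\sum_{i_1+\cdots+i_k=n} f_{m-1}(i_1)\cdots f_{m-1}(i_k)$, the sum over all $k$-tuples of positive integers with sum $n$, and $f_m(n)=\sum_{k=1}^n c_m(n,k)$. The convention $0^0=1$ is used. -}

module Defs where

open import Data.Nat using (ℕ; zero; suc; _+_; _*_; _∸_; _^_)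
open import Data.Nat.Combinatorics using (_C_)
open import Data.List using (List; []; _∷_; map)
open import Data.Nat.ListAction using (sum)

range : ℕ → ℕ → List ℕ
range lo hi = go (suc hi ∸ lo) lo
  where
  go : ℕ → ℕ → List ℕ
  go zero    _ = []
  go (suc r) x = x ∷ go r (suc x)

Σ[_≤_≤_] : ℕ → (ℕ → ℕ) → ℕ → ℕ
Σ[ lo ≤ g ≤ hi ] = sum (map g (range lo hi))

-- compSum f n k = Σ over k-tuples (i₁,…,i_k) of POSITIVE integers with
-- i₁ + ⋯ + i_k = n of f i₁ ⋯ f i_k, computed by splitting off the first part i₁.
compSum : (ℕ → ℕ) → ℕ → ℕ → ℕ
compSum f zero    zero    = 1
compSum f (suc n) zero    = 0
compSum f n       (suc k) = Σ[ 1 ≤ (λ i → f i * compSum f (n ∸ i) k) ≤ n ]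

fIter : (ℕ → ℕ) → ℕ → ℕ → ℕ
fIter f₀ zero    n = f₀ n
fIter f₀ (suc m) n = Σ[ 1 ≤ (λ k → compSum (fIter f₀ m) n k) ≤ n ]

-- c_m(n,k) for m ≥ 1 : c (suc m') n k = c_{m'+1}(n,k)
cCoef : (ℕ → ℕ) → ℕ → ℕ → ℕ → ℕ
cCoef f₀ zero    n k = 0   -- c_0 is not defined in the paper; never used
cCoef f₀ (suc m) n k = compSum (fIter f₀ m) n k

f0 : ℕ → ℕ → ℕ
f0 a n = (n + a ∸ 2) C (a ∸ 1)

-- Let F_m = Σ_{n≥1} f_m(n) xⁿ. Then c_{m+1}(n,k) is the coefficient of xⁿ in F_m^k, and
-- F_{m+1} = Σ_{k≥1} F_m^k, i.e. F_{m+1} = F_m + F_m F_{m+1}. By induction F_m = g / (1 − m g)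
-- with g = F_0 = x / (1 − x)^a, whence F_m^k = Σ_i binom(i−1, k−1) m^(i−k) g^i (Pascal's rule),
-- and [xⁿ] g^i = binom(n + a i − i − 1, a i − 1). Series are coefficient sequences ℕ → ℕ, so there
-- is no division: each of these identities is proved by showing that both sides solve X = Q + c G X
-- for some G without constant term, an equation with at most one solution.

module Submission where

open import Defs
open import Data.Nat
open import Data.Nat.Properties
open import Data.Nat.Induction using (<-rec)
open import Data.Nat.Combinatorics using (_C_; nCn≡1; nCk+nC[k+1]≡[n+1]C[k+1]; k>n⇒nCk≡0)
open import Data.Product using (_×_; _,_)
open import Function using (_∘_)
open import Algebra.Properties.CommutativeSemigroup +-commutativeSemigroup using () renaming (interchange to +-interchange)
open import Algebra.Properties.CommutativeSemigroup *-commutativeSemigroup using (x∙yz≈y∙xz)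
open import Data.Nat.Solver using (module +-*-Solver)
open +-*-Solver using (solve; _:+_; _:*_; _:=_; con)
open import Relation.Nullary using (yes; no)
open import Relation.Binary.PropositionalEquality
open ≡-Reasoning

∑< : ℕ → (ℕ → ℕ) → ℕ
∑< zero    f = 0
∑< (suc n) f = ∑< n f + f n

infix 8 ∑<
syntax ∑< n (λ j → e) = ∑[ j < n ] e

module _ {f g : ℕ → ℕ} where

  ∑<-cong : ∀ n → (∀ j → j < n → f j ≡ g j) → ∑< n f ≡ ∑< n g
  ∑<-cong zero    _  = refl
  ∑<-cong (suc n) eq = cong₂ _+_ (∑<-cong n (λ j j<n → eq j (m<n⇒m<1+n j<n))) (eq n ≤-refl)

  ∑<-+ : ∀ n → ∑[ j < n ] (f j + g j) ≡ ∑< n f + ∑< n g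
  ∑<-+ zero    = refl
  ∑<-+ (suc n) = trans (cong (_+ (f n + g n)) (∑<-+ n)) (+-interchange (∑< n f) (∑< n g) (f n) (g n))

∑<-zero : ∀ {f} n → (∀ j → j < n → f j ≡ 0) → ∑< n f ≡ 0
∑<-zero zero    _  = refl
∑<-zero (suc n) eq = cong₂ _+_ (∑<-zero n (λ j j<n → eq j (m<n⇒m<1+n j<n))) (eq n ≤-refl)

∑<-distribˡ : ∀ c f n → ∑[ j < n ] (c * f j) ≡ c * ∑< n f
∑<-distribˡ c f zero    = sym (*-zeroʳ c)
∑<-distribˡ c f (suc n) = trans (cong (_+ c * f n) (∑<-distribˡ c f n)) (sym (*-distribˡ-+ c (∑< n f) (f n)))

∑<-sucˡ : ∀ f n → ∑< (suc n) f ≡ f 0 + ∑< n (f ∘ suc)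
∑<-sucˡ f zero    = +-comm 0 (f 0)
∑<-sucˡ f (suc n) = trans (cong (_+ f (suc n)) (∑<-sucˡ f n)) (+-assoc (f 0) _ _)

∑<-split : ∀ f m n → ∑< (m + n) f ≡ ∑< m f + ∑[ j < n ] f (m + j)
∑<-split f m zero    = trans (cong (λ k → ∑< k f) (+-identityʳ m)) (sym (+-identityʳ _))
∑<-split f m (suc n) = begin
  ∑< (m + suc n) f                           ≡⟨ cong (λ k → ∑< k f) (+-suc m n) ⟩
  ∑< (m + n) f + f (m + n)                   ≡⟨ cong (_+ f (m + n)) (∑<-split f m n) ⟩
  ∑< m f + ∑[ j < n ] f (m + j) + f (m + n)  ≡⟨ +-assoc (∑< m f) _ _ ⟩
  ∑< m f + ∑[ j < suc n ] f (m + j)          ∎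

∑<-vanishing-tail : ∀ f {m n} → m ≤ n → (∀ j → m ≤ j → f j ≡ 0) → ∑< n f ≡ ∑< m f
∑<-vanishing-tail f {m} {n} m≤n tail0 = begin
  ∑< n f
    ≡⟨ cong (λ k → ∑< k f) (m+[n∸m]≡n m≤n) ⟨
  ∑< (m + (n ∸ m)) f
    ≡⟨ ∑<-split f m (n ∸ m) ⟩
  ∑< m f + ∑[ j < n ∸ m ] f (m + j)
    ≡⟨ cong (∑< m f +_) (∑<-zero (n ∸ m) (λ j _ → tail0 (m + j) (m≤m+n m j))) ⟩
  ∑< m f + 0
    ≡⟨ +-identityʳ _ ⟩
  ∑< m f ∎

∑<-vanishing-head : ∀ f {k n} → k ≤ n → (∀ j → j < k → f j ≡ 0) → ∑< n f ≡ ∑[ j < n ∸ k ] f (k + j)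
∑<-vanishing-head f {k} {n} k≤n head0 = begin
  ∑< n f                                   ≡⟨ cong (λ i → ∑< i f) (m+[n∸m]≡n k≤n) ⟨
  ∑< (k + (n ∸ k)) f                       ≡⟨ ∑<-split f k (n ∸ k) ⟩
  ∑< k f + ∑[ j < n ∸ k ] f (k + j)        ≡⟨ cong (_+ ∑[ j < n ∸ k ] f (k + j)) (∑<-zero k head0) ⟩
  ∑[ j < n ∸ k ] f (k + j)                 ∎

∑<-comm : ∀ (F : ℕ → ℕ → ℕ) m n → ∑[ i < m ] ∑[ j < n ] F i j ≡ ∑[ j < n ] ∑[ i < m ] F i j
∑<-comm F zero    n = sym (∑<-zero n (λ _ _ → refl))
∑<-comm F (suc m) n = trans (cong (_+ ∑< n (F m)) (∑<-comm F m n)) (sym (∑<-+ n))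

Σ[]≡∑< : ∀ g lo hi → Σ[ lo ≤ g ≤ hi ] ≡ ∑[ j < suc hi ∸ lo ] g (lo + j)
Σ[]≡∑< g lo hi = go (suc hi ∸ lo) lo refl
  where
  go : ∀ r lo → suc hi ∸ lo ≡ r → Σ[ lo ≤ g ≤ hi ] ≡ ∑[ j < r ] g (lo + j)
  go zero lo eq rewrite eq = refl
  go (suc r) lo eq with lo ≤? hi
  ... | no lo≰hi with () ← trans (sym eq) (m≤n⇒m∸n≡0 (≰⇒> lo≰hi))
  ... | yes lo≤hi rewrite +-∸-assoc 1 lo≤hi = begin
    g lo + Σ[ suc lo ≤ g ≤ hi ]
      ≡⟨ cong (g lo +_) (go r (suc lo) (suc-injective eq)) ⟩
    g lo + ∑[ j < r ] g (suc lo + j)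
      ≡⟨ cong₂ _+_ (cong g (+-identityʳ lo)) (∑<-cong r (λ j _ → cong g (+-suc lo j))) ⟨
    g (lo + 0) + ∑[ j < r ] g (lo + suc j)
      ≡⟨ ∑<-sucˡ (λ j → g (lo + j)) r ⟨
    ∑[ j < suc r ] g (lo + j) ∎

Series : Set
Series = ℕ → ℕ

infix  4 _≈_
infixl 6 _⊕_
infixr 8 _·_
infixl 7 _∗_
infixr 8 _∗^_

_≈_ : Series → Series → Set
A ≈ B = ∀ n → A n ≡ B n

_⊕_ : Series → Series → Series
(A ⊕ B) n = A n + B n

_·_ : ℕ → Series → Series
(c · A) n = c * A n

_∗_ : Series → Series → Series
(A ∗ B) n = ∑[ j < suc n ] (A j * B (n ∸ j))

𝟎 : Series
𝟎 _ = 0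

𝟏 : Series
𝟏 zero    = 1
𝟏 (suc n) = 0

_∗^_ : Series → ℕ → Series
A ∗^ zero  = 𝟏
A ∗^ suc k = A ∗ A ∗^ k

∗-cong : ∀ {A A′ B B′} → A ≈ A′ → B ≈ B′ → A ∗ B ≈ A′ ∗ B′
∗-cong A≈A′ B≈B′ n = ∑<-cong (suc n) (λ j _ → cong₂ _*_ (A≈A′ j) (B≈B′ (n ∸ j)))

∗-congˡ : ∀ {A A′} B → A ≈ A′ → A ∗ B ≈ A′ ∗ B
∗-congˡ {A} {A′} B A≈A′ = ∗-cong {A} {A′} {B} {B} A≈A′ (λ _ → refl)

∗-congʳ : ∀ A {B B′} → B ≈ B′ → A ∗ B ≈ A ∗ B′
∗-congʳ A {B} {B′} = ∗-cong {A} {A} {B} {B′} (λ _ → refl)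

∗-sucˡ : ∀ A B → (A ∗ B) ∘ suc ≈ A 0 · B ∘ suc ⊕ A ∘ suc ∗ B
∗-sucˡ A B n = ∑<-sucˡ (λ j → A j * B (suc n ∸ j)) (suc n)

∗-sucʳ : ∀ A B n → (A ∗ B) (suc n) ≡ (A ∗ B ∘ suc) n + A (suc n) * B 0
∗-sucʳ A B n = cong₂ _+_
  (∑<-cong (suc n) (λ { j (s≤s j≤n) → cong (λ t → A j * B t) (+-∸-assoc 1 j≤n) }))
  (cong (λ t → A (suc n) * B t) (n∸n≡0 n))

∗-comm : ∀ A B → A ∗ B ≈ B ∗ A
∗-comm A B zero    = *-comm (A 0) (B 0)
∗-comm A B (suc n) = begin
  (A ∗ B) (suc n)
    ≡⟨ ∗-sucˡ A B n ⟩
  A 0 * B (suc n) + (A ∘ suc ∗ B) n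
    ≡⟨ cong₂ _+_ (*-comm (A 0) (B (suc n))) (∗-comm (A ∘ suc) B n) ⟩
  B (suc n) * A 0 + (B ∗ A ∘ suc) n
    ≡⟨ +-comm (B (suc n) * A 0) _ ⟩
  (B ∗ A ∘ suc) n + B (suc n) * A 0
    ≡⟨ ∗-sucʳ B A n ⟨
  (B ∗ A) (suc n) ∎

∗-zeroʳ : ∀ A → A ∗ 𝟎 ≈ 𝟎
∗-zeroʳ A n = ∑<-zero (suc n) (λ j _ → *-zeroʳ (A j))

∗-identityʳ : ∀ A → A ∗ 𝟏 ≈ A
∗-identityʳ A zero    = *-identityʳ (A 0)
∗-identityʳ A (suc n) = trans (∗-sucʳ A 𝟏 n) (cong₂ _+_ (∗-zeroʳ A n) (*-identityʳ (A (suc n))))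

∗-distribˡ-⊕ : ∀ A B D → A ∗ (B ⊕ D) ≈ A ∗ B ⊕ A ∗ D
∗-distribˡ-⊕ A B D n =
  trans (∑<-cong (suc n) (λ j _ → *-distribˡ-+ (A j) (B (n ∸ j)) (D (n ∸ j)))) (∑<-+ (suc n))

∗-distribʳ-⊕ : ∀ A B D → (B ⊕ D) ∗ A ≈ B ∗ A ⊕ D ∗ A
∗-distribʳ-⊕ A B D n =
  trans (∑<-cong (suc n) (λ j _ → *-distribʳ-+ (A (n ∸ j)) (B j) (D j))) (∑<-+ (suc n))

∗-scaleʳ : ∀ c A B → A ∗ c · B ≈ c · (A ∗ B)
∗-scaleʳ c A B n =
  trans (∑<-cong (suc n) (λ j _ → x∙yz≈y∙xz (A j) c (B (n ∸ j)))) (∑<-distribˡ c _ (suc n))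

∗-scaleˡ : ∀ c A B → c · A ∗ B ≈ c · (A ∗ B)
∗-scaleˡ c A B n =
  trans (∑<-cong (suc n) (λ j _ → *-assoc c (A j) (B (n ∸ j)))) (∑<-distribˡ c _ (suc n))

∗-assoc : ∀ A B D → (A ∗ B) ∗ D ≈ A ∗ (B ∗ D)
∗-assoc A B D zero    = *-assoc (A 0) (B 0) (D 0)
∗-assoc A B D (suc n) = begin
  ((A ∗ B) ∗ D) (suc n)
    ≡⟨ ∗-sucˡ (A ∗ B) D n ⟩
  a * b * D (suc n) + ((A ∗ B) ∘ suc ∗ D) n
    ≡⟨ cong (a * b * D (suc n) +_) (∗-congˡ D (∗-sucˡ A B) n) ⟩
  a * b * D (suc n) + ((a · B ∘ suc ⊕ A ∘ suc ∗ B) ∗ D) n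
    ≡⟨ cong (a * b * D (suc n) +_) (∗-distribʳ-⊕ D (a · B ∘ suc) (A ∘ suc ∗ B) n) ⟩
  a * b * D (suc n) + ((a · B ∘ suc ∗ D) n + (A ∘ suc ∗ B ∗ D) n)
    ≡⟨ cong₂ (λ x y → a * b * D (suc n) + (x + y)) (∗-scaleˡ a (B ∘ suc) D n) (∗-assoc (A ∘ suc) B D n) ⟩
  a * b * D (suc n) + (a * (B ∘ suc ∗ D) n + (A ∘ suc ∗ (B ∗ D)) n)
    ≡⟨ regroup a b (D (suc n)) ((B ∘ suc ∗ D) n) ((A ∘ suc ∗ (B ∗ D)) n) ⟩
  a * (b * D (suc n) + (B ∘ suc ∗ D) n) + (A ∘ suc ∗ (B ∗ D)) n
    ≡⟨ cong (λ x → a * x + (A ∘ suc ∗ (B ∗ D)) n) (∗-sucˡ B D n) ⟨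
  a * (B ∗ D) (suc n) + (A ∘ suc ∗ (B ∗ D)) n
    ≡⟨ ∗-sucˡ A (B ∗ D) n ⟨
  (A ∗ (B ∗ D)) (suc n) ∎
  where
  a b : ℕ
  a = A 0
  b = B 0
  regroup : ∀ x y z u v → x * y * z + (x * u + v) ≡ x * (y * z + u) + v
  regroup = solve 5 (λ x y z u v → x :* y :* z :+ (x :* u :+ v) := x :* (y :* z :+ u) :+ v) refl

∗-leftComm : ∀ A B D → A ∗ (B ∗ D) ≈ B ∗ (A ∗ D)
∗-leftComm A B D n = begin
  (A ∗ (B ∗ D)) n   ≡⟨ ∗-assoc A B D n ⟨
  ((A ∗ B) ∗ D) n   ≡⟨ ∗-congˡ D (∗-comm A B) n ⟩
  ((B ∗ A) ∗ D) n   ≡⟨ ∗-assoc B A D n ⟩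
  (B ∗ (A ∗ D)) n   ∎

∗-congʳ-≤ : ∀ A {B B′ n} → (∀ j → j ≤ n → B j ≡ B′ j) → (A ∗ B) n ≡ (A ∗ B′) n
∗-congʳ-≤ A {n = n} B≡B′ = ∑<-cong (suc n) (λ j _ → cong (A j *_) (B≡B′ (n ∸ j) (m∸n≤m n j)))

a≡0⇒a*x≡a*y : ∀ {a x y} → a ≡ 0 → a * x ≡ a * y
a≡0⇒a*x≡a*y refl = refl

∗-congʳ-< : ∀ A {B B′ n} → A 0 ≡ 0 → (∀ j → j < n → B j ≡ B′ j) → (A ∗ B) n ≡ (A ∗ B′) n
∗-congʳ-< A {B} {B′} {zero}  A0≡0 _   = a≡0⇒a*x≡a*y A0≡0
∗-congʳ-< A {B} {B′} {suc n} A0≡0 B≡B′ = begin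
  (A ∗ B) (suc n)
    ≡⟨ ∗-sucˡ A B n ⟩
  A 0 * B (suc n) + (A ∘ suc ∗ B) n
    ≡⟨ cong₂ _+_ (a≡0⇒a*x≡a*y A0≡0) (∗-congʳ-≤ (A ∘ suc) (λ j j≤n → B≡B′ j (s≤s j≤n))) ⟩
  A 0 * B′ (suc n) + (A ∘ suc ∗ B′) n
    ≡⟨ ∗-sucˡ A B′ n ⟨
  (A ∗ B′) (suc n) ∎

fixpoint-unique : ∀ Q G c {X Y} → G 0 ≡ 0 →
  X ≈ Q ⊕ c · (G ∗ X) → Y ≈ Q ⊕ c · (G ∗ Y) → X ≈ Y
fixpoint-unique Q G c {X} {Y} G0≡0 X-fix Y-fix = <-rec (λ n → X n ≡ Y n) step
  where
  step : ∀ n → (∀ {j} → j < n → X j ≡ Y j) → X n ≡ Y n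
  step n X≡Y-below = begin
    X n                    ≡⟨ X-fix n ⟩
    Q n + c * (G ∗ X) n    ≡⟨ cong (λ t → Q n + c * t) (∗-congʳ-< G G0≡0 (λ j → X≡Y-below)) ⟩
    Q n + c * (G ∗ Y) n    ≡⟨ Y-fix n ⟨
    Y n                    ∎

∗-distribˡ-∑ : ∀ A (B : ℕ → Series) r → A ∗ (λ t → ∑[ j < r ] B j t) ≈ (λ n → ∑[ j < r ] (A ∗ B j) n)
∗-distribˡ-∑ A B r n = begin
  ∑[ i < suc n ] (A i * ∑[ j < r ] B j (n ∸ i))
    ≡⟨ ∑<-cong (suc n) (λ i _ → ∑<-distribˡ (A i) (λ j → B j (n ∸ i)) r) ⟨
  ∑[ i < suc n ] ∑[ j < r ] (A i * B j (n ∸ i))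
    ≡⟨ ∑<-comm (λ i j → A i * B j (n ∸ i)) (suc n) r ⟩
  ∑[ j < r ] (A ∗ B j) n ∎

∗^-cong : ∀ {A A′} → A ≈ A′ → ∀ k → A ∗^ k ≈ A′ ∗^ k
∗^-cong A≈A′ zero    n = refl
∗^-cong A≈A′ (suc k)   = ∗-cong A≈A′ (∗^-cong A≈A′ k)

∗^-vanish : ∀ {A} → A 0 ≡ 0 → ∀ {k t} → t < k → (A ∗^ k) t ≡ 0
∗^-vanish {A} A0≡0 {suc k} {t} (s≤s t≤k) = begin
  (A ∗ A ∗^ k) t  ≡⟨ ∗-congʳ-< A A0≡0 (λ j j<t → ∗^-vanish {A} A0≡0 (<-≤-trans j<t t≤k)) ⟩
  (A ∗ 𝟎) t       ≡⟨ ∗-zeroʳ A t ⟩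
  0               ∎

∗^-+ : ∀ A s t → A ∗^ (s + t) ≈ A ∗^ s ∗ A ∗^ t
∗^-+ A zero    t n = trans (sym (∗-identityʳ (A ∗^ t) n)) (∗-comm (A ∗^ t) 𝟏 n)
∗^-+ A (suc s) t n = begin
  (A ∗ A ∗^ (s + t)) n      ≡⟨ ∗-congʳ A (∗^-+ A s t) n ⟩
  (A ∗ (A ∗^ s ∗ A ∗^ t)) n ≡⟨ ∗-assoc A (A ∗^ s) (A ∗^ t) n ⟨
  (A ∗ A ∗^ s ∗ A ∗^ t) n   ∎

∗^-* : ∀ A s i → (A ∗^ s) ∗^ i ≈ A ∗^ (s * i)
∗^-* A s zero    n rewrite *-zeroʳ s = refl
∗^-* A s (suc i) n = begin
  (A ∗^ s ∗ (A ∗^ s) ∗^ i) n   ≡⟨ ∗-congʳ (A ∗^ s) (∗^-* A s i) n ⟩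
  (A ∗^ s ∗ A ∗^ (s * i)) n    ≡⟨ ∗^-+ A s (s * i) n ⟨
  (A ∗^ (s + s * i)) n         ≡⟨ cong (λ e → (A ∗^ e) n) (*-suc s i) ⟨
  (A ∗^ (s * suc i)) n         ∎

shift : Series → Series
shift A zero    = 0
shift A (suc n) = A n

shift^ : ℕ → Series → Series
shift^ zero    A = A
shift^ (suc i) A = shift (shift^ i A)

shift-cong : ∀ {A B} → A ≈ B → shift A ≈ shift B
shift-cong A≈B zero    = refl
shift-cong A≈B (suc n) = A≈B n

shift^-+ : ∀ i A r → shift^ i A (i + r) ≡ A r
shift^-+ zero    A r = refl
shift^-+ (suc i) A r = shift^-+ i A r

∗-shiftˡ : ∀ A B → shift A ∗ B ≈ shift (A ∗ B)
∗-shiftˡ A B zero    = refl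
∗-shiftˡ A B (suc n) = ∗-sucˡ (shift A) B n

∗-shiftʳ : ∀ A B → A ∗ shift B ≈ shift (A ∗ B)
∗-shiftʳ A B n = trans (∗-comm A (shift B) n) (trans (∗-shiftˡ B A n) (shift-cong (∗-comm B A) n))

∗-shift^ʳ : ∀ A B i → A ∗ shift^ i B ≈ shift^ i (A ∗ B)
∗-shift^ʳ A B zero    n = refl
∗-shift^ʳ A B (suc i) n = trans (∗-shiftʳ A (shift^ i B) n) (shift-cong (∗-shift^ʳ A B i) n)

shift-∗^ : ∀ A i → shift A ∗^ i ≈ shift^ i (A ∗^ i)
shift-∗^ A zero    n = refl
shift-∗^ A (suc i) n = begin
  (shift A ∗ shift A ∗^ i) n          ≡⟨ ∗-congʳ (shift A) (shift-∗^ A i) n ⟩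
  (shift A ∗ shift^ i (A ∗^ i)) n     ≡⟨ ∗-shiftˡ A (shift^ i (A ∗^ i)) n ⟩
  shift (A ∗ shift^ i (A ∗^ i)) n     ≡⟨ shift-cong (∗-shift^ʳ A (A ∗^ i) i) n ⟩
  shift^ (suc i) (A ∗^ suc i) n       ∎

binomialWeight : ℕ → ℕ → (ℕ → ℕ)
binomialWeight c k j = c ^ (j ∸ k) * (j C k)

binomialWeight-below : ∀ c {k j} → j < k → binomialWeight c k j ≡ 0
binomialWeight-below c {k} {j} j<k = trans (cong (c ^ (j ∸ k) *_) (k>n⇒nCk≡0 j<k)) (*-zeroʳ (c ^ (j ∸ k)))

binomialWeight-pascal : ∀ c k →
  binomialWeight c (suc k) ≈ shift (binomialWeight c k) ⊕ c · shift (binomialWeight c (suc k))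
binomialWeight-pascal c k zero    = sym (*-zeroʳ c)
binomialWeight-pascal c k (suc j) = begin
  c ^ (j ∸ k) * (suc j C suc k)
    ≡⟨ cong (c ^ (j ∸ k) *_) (nCk+nC[k+1]≡[n+1]C[k+1] j k) ⟨
  c ^ (j ∸ k) * (j C k + j C suc k)
    ≡⟨ *-distribˡ-+ (c ^ (j ∸ k)) (j C k) (j C suc k) ⟩
  c ^ (j ∸ k) * (j C k) + c ^ (j ∸ k) * (j C suc k)
    ≡⟨ cong (c ^ (j ∸ k) * (j C k) +_) factor-c ⟩
  c ^ (j ∸ k) * (j C k) + c * (c ^ (j ∸ suc k) * (j C suc k)) ∎
  where
  factor-c : c ^ (j ∸ k) * (j C suc k) ≡ c * (c ^ (j ∸ suc k) * (j C suc k))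
  factor-c with suc k ≤? j
  ... | yes k<j = trans (cong (λ e → c ^ e * (j C suc k)) (+-∸-assoc 1 k<j)) (*-assoc c (c ^ (j ∸ suc k)) (j C suc k))
  ... | no  k≮j = begin
    c ^ (j ∸ k) * (j C suc k)                    ≡⟨ cong (c ^ (j ∸ k) *_) (k>n⇒nCk≡0 (≰⇒> k≮j)) ⟩
    c ^ (j ∸ k) * 0                              ≡⟨ *-zeroʳ (c ^ (j ∸ k)) ⟩
    0                                            ≡⟨ *-zeroʳ c ⟨
    c * 0                                        ≡⟨ cong (c *_) (binomialWeight-below c (≰⇒> k≮j)) ⟨
    c * (c ^ (j ∸ suc k) * (j C suc k))          ∎

module PowerSum (g : Series) (g0≡0 : g 0 ≡ 0) where

  -- Σⱼ h j · g^(j+1); the coefficient of xⁿ only sees j < n because g^(j+1) has order j+1.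
  powerSum : (ℕ → ℕ) → Series
  powerSum h n = ∑[ j < n ] (h j * (g ∗^ suc j) n)

  powerSum-extend : ∀ h {n N} → n ≤ N → powerSum h n ≡ ∑[ j < N ] (h j * (g ∗^ suc j) n)
  powerSum-extend h {n} n≤N = sym (∑<-vanishing-tail (λ j → h j * (g ∗^ suc j) n) n≤N
    (λ j n≤j → trans (cong (h j *_) (∗^-vanish {g} g0≡0 (s≤s n≤j))) (*-zeroʳ (h j))))

  powerSum-𝟏 : powerSum 𝟏 ≈ g
  powerSum-𝟏 zero     = sym g0≡0
  powerSum-𝟏 (suc n′) = begin
    powerSum 𝟏 (suc n′)
      ≡⟨ ∑<-sucˡ (λ j → 𝟏 j * (g ∗^ suc j) (suc n′)) n′ ⟩
    1 * (g ∗ 𝟏) (suc n′) + ∑[ j < n′ ] (0 * (g ∗^ suc (suc j)) (suc n′))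
      ≡⟨ cong₂ _+_ (*-identityˡ _) (∑<-zero n′ (λ _ _ → refl)) ⟩
    (g ∗ 𝟏) (suc n′) + 0
      ≡⟨ +-identityʳ _ ⟩
    (g ∗ 𝟏) (suc n′)
      ≡⟨ ∗-identityʳ g (suc n′) ⟩
    g (suc n′) ∎

  ∗-powerSum : ∀ h → g ∗ powerSum h ≈ powerSum (shift h)
  ∗-powerSum h zero     = *-zeroʳ (g 0)
  ∗-powerSum h n@(suc _) = begin
    (g ∗ powerSum h) n
      ≡⟨ ∗-congʳ-≤ g (λ t t≤n → powerSum-extend h t≤n) ⟩
    (g ∗ (λ t → ∑[ j < n ] (h j * (g ∗^ suc j) t))) n
      ≡⟨ ∗-distribˡ-∑ g (λ j t → h j * (g ∗^ suc j) t) n n ⟩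
    ∑[ j < n ] (g ∗ h j · g ∗^ suc j) n
      ≡⟨ ∑<-cong n (λ j _ → ∗-scaleʳ (h j) g (g ∗^ suc j) n) ⟩
    ∑[ j < n ] (h j * (g ∗^ suc (suc j)) n)
      ≡⟨ ∑<-sucˡ (λ j → shift h j * (g ∗^ suc j) n) n ⟨
    ∑[ j < suc n ] (shift h j * (g ∗^ suc j) n)
      ≡⟨ powerSum-extend (shift h) (n≤1+n n) ⟨
    powerSum (shift h) n ∎

  powerSum-fixpoint : ∀ {h h₀} c → h ≈ h₀ ⊕ c · shift h → powerSum h ≈ powerSum h₀ ⊕ c · (g ∗ powerSum h)
  powerSum-fixpoint {h} {h₀} c h≈ n = begin
    ∑[ j < n ] (h j * β j)
      ≡⟨ ∑<-cong n (λ j _ → cong (_* β j) (h≈ j)) ⟩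
    ∑[ j < n ] ((h₀ j + c * shift h j) * β j)
      ≡⟨ ∑<-cong n (λ j _ → distrib (h₀ j) (shift h j) (β j)) ⟩
    ∑[ j < n ] (h₀ j * β j + c * (shift h j * β j))
      ≡⟨ ∑<-+ n ⟩
    powerSum h₀ n + ∑[ j < n ] (c * (shift h j * β j))
      ≡⟨ cong (powerSum h₀ n +_) (∑<-distribˡ c (λ j → shift h j * β j) n) ⟩
    powerSum h₀ n + c * powerSum (shift h) n
      ≡⟨ cong (λ t → powerSum h₀ n + c * t) (∗-powerSum h n) ⟨
    powerSum h₀ n + c * (g ∗ powerSum h) n ∎
    where
    β : ℕ → ℕ
    β j = (g ∗^ suc j) n
    distrib : ∀ x y z → (x + c * y) * z ≡ x * z + c * (y * z)
    distrib x y z = trans (*-distribʳ-+ z x (c * y)) (cong (x * z +_) (*-assoc c y z))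

  -- Σⱼ cʲ g^(j+1) = g / (1 - c g)
  geometric : ℕ → Series
  geometric c = powerSum (c ^_)

  geometric-fixpoint : ∀ c → geometric c ≈ g ⊕ c · (g ∗ geometric c)
  geometric-fixpoint c n = trans (powerSum-fixpoint c c^≈ n) (cong (_+ c * (g ∗ geometric c) n) (powerSum-𝟏 n))
    where
    c^≈ : (c ^_) ≈ 𝟏 ⊕ c · shift (c ^_)
    c^≈ zero    = cong suc (sym (*-zeroʳ c))
    c^≈ (suc j) = refl

  geometric-zero : geometric 0 ≈ g
  geometric-zero n = trans (∑<-cong n (λ j _ → cong (_* (g ∗^ suc j) n) (0^≡𝟏 j))) (powerSum-𝟏 n)
    where
    0^≡𝟏 : (0 ^_) ≈ 𝟏
    0^≡𝟏 zero    = refl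
    0^≡𝟏 (suc j) = refl

  geometric-suc : ∀ m → geometric (suc m) ≈ geometric m ⊕ 1 · (geometric m ∗ geometric (suc m))
  geometric-suc m n = sym (fixpoint-unique g g (suc m) g0≡0 Z-fix (geometric-fixpoint (suc m)) n)
    where
    u v Z : Series
    u = geometric m
    v = geometric (suc m)
    Z = u ⊕ 1 · (u ∗ v)
    Z-fix : Z ≈ g ⊕ suc m · (g ∗ Z)
    Z-fix n = begin
      u n + 1 * (u ∗ v) n
        ≡⟨ cong₂ (λ p q → p + 1 * q) (geometric-fixpoint m n) (∗-congʳ u (geometric-fixpoint (suc m)) n) ⟩
      g n + m * x + 1 * (u ∗ (g ⊕ suc m · (g ∗ v))) n
        ≡⟨ cong (λ q → g n + m * x + 1 * q) (∗-distribˡ-⊕ u g (suc m · (g ∗ v)) n) ⟩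
      g n + m * x + 1 * ((u ∗ g) n + (u ∗ suc m · (g ∗ v)) n)
        ≡⟨ cong₂ (λ p q → g n + m * x + 1 * (p + q)) (∗-comm u g n) (∗-scaleʳ (suc m) u (g ∗ v) n) ⟩
      g n + m * x + 1 * (x + suc m * (u ∗ (g ∗ v)) n)
        ≡⟨ cong (λ q → g n + m * x + 1 * (x + suc m * q)) (∗-leftComm u g v n) ⟩
      g n + m * x + 1 * (x + suc m * y)
        ≡⟨ regroup (g n) m x y ⟩
      g n + suc m * (x + 1 * y)
        ≡⟨ cong (λ q → g n + suc m * q) (trans (∗-distribˡ-⊕ g u (1 · (u ∗ v)) n) (cong (x +_) (∗-scaleʳ 1 g (u ∗ v) n))) ⟨
      g n + suc m * (g ∗ Z) n ∎
      where
      x y : ℕ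
      x = (g ∗ u) n
      y = (g ∗ (u ∗ v)) n
      regroup : ∀ a m x y → a + m * x + 1 * (x + suc m * y) ≡ a + suc m * (x + 1 * y)
      regroup = solve 4 (λ a m x y → a :+ m :* x :+ con 1 :* (x :+ (con 1 :+ m) :* y)
                                   := a :+ (con 1 :+ m) :* (x :+ con 1 :* y)) refl

  geometric-power : ∀ c k → geometric c ∗^ suc k ≈ powerSum (binomialWeight c k)
  geometric-power c zero    n = trans (∗-identityʳ (geometric c) n)
    (∑<-cong n (λ j _ → cong (_* (g ∗^ suc j) n) (sym (*-identityʳ (c ^ j)))))
  geometric-power c (suc k) n = begin
    (G ∗ G ∗^ suc k) n   ≡⟨ ∗-congʳ G (geometric-power c k) n ⟩
    (G ∗ D k) n          ≡⟨ fixpoint-unique (g ∗ D k) g c g0≡0 G∗Dk-fix Dk+1-fix n ⟩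
    D (suc k) n          ∎
    where
    G : Series
    G = geometric c
    D : ℕ → Series
    D k = powerSum (binomialWeight c k)
    G∗Dk-fix : G ∗ D k ≈ g ∗ D k ⊕ c · (g ∗ (G ∗ D k))
    G∗Dk-fix n = begin
      (G ∗ D k) n
        ≡⟨ ∗-congˡ (D k) (geometric-fixpoint c) n ⟩
      ((g ⊕ c · (g ∗ G)) ∗ D k) n
        ≡⟨ ∗-distribʳ-⊕ (D k) g (c · (g ∗ G)) n ⟩
      (g ∗ D k) n + (c · (g ∗ G) ∗ D k) n
        ≡⟨ cong ((g ∗ D k) n +_) (∗-scaleˡ c (g ∗ G) (D k) n) ⟩
      (g ∗ D k) n + c * ((g ∗ G) ∗ D k) n
        ≡⟨ cong (λ t → (g ∗ D k) n + c * t) (∗-assoc g G (D k) n) ⟩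
      (g ∗ D k) n + c * (g ∗ (G ∗ D k)) n ∎
    Dk+1-fix : D (suc k) ≈ g ∗ D k ⊕ c · (g ∗ D (suc k))
    Dk+1-fix n = trans (powerSum-fixpoint c (binomialWeight-pascal c k) n)
                       (cong (_+ c * (g ∗ D (suc k)) n) (sym (∗-powerSum (binomialWeight c k) n)))

gf : (ℕ → ℕ) → Series
gf f zero    = 0
gf f (suc n) = f (suc n)

compSum≡gf∗^ : ∀ f k n → compSum f n k ≡ (gf f ∗^ k) n
compSum≡gf∗^ f zero    zero    = refl
compSum≡gf∗^ f zero    (suc n) = refl
compSum≡gf∗^ f (suc k) zero    = refl
compSum≡gf∗^ f (suc k) (suc n) = begin
  Σ[ 1 ≤ (λ i → f i * compSum f (suc n ∸ i) k) ≤ suc n ]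
    ≡⟨ Σ[]≡∑< _ 1 (suc n) ⟩
  ∑[ j < suc n ] (f (suc j) * compSum f (n ∸ j) k)
    ≡⟨ ∑<-cong (suc n) (λ j _ → cong (f (suc j) *_) (compSum≡gf∗^ f k (n ∸ j))) ⟩
  ∑[ j < suc n ] (f (suc j) * (gf f ∗^ k) (n ∸ j))
    ≡⟨ ∗-sucˡ (gf f) (gf f ∗^ k) n ⟨
  (gf f ∗^ suc k) (suc n) ∎

module _ (f₀ : ℕ → ℕ) where

  open PowerSum (gf f₀) refl

  private
    F : ℕ → Series
    F m = gf (fIter f₀ m)

  fIter-suc : ∀ m n → fIter f₀ (suc m) n ≡ ∑[ j < n ] (F m ∗^ suc j) n
  fIter-suc m n = trans (Σ[]≡∑< _ 1 n) (∑<-cong n (λ j _ → compSum≡gf∗^ (fIter f₀ m) (suc j) n))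

  -- Σ_{k≥1} F_m^k = F_m + F_m · Σ_{k≥1} F_m^k; cutting the sum at k ≤ n is harmless
  -- since F_m^k has order k.
  gf-fIter-suc : ∀ m → F (suc m) ≈ F m ⊕ 1 · (F m ∗ F (suc m))
  gf-fIter-suc m zero     = refl
  gf-fIter-suc m N@(suc n′) = begin
    fIter f₀ (suc m) N
      ≡⟨ fIter-suc m N ⟩
    ∑[ j < N ] (F m ∗^ suc j) N
      ≡⟨ ∑<-sucˡ (λ j → (F m ∗^ suc j) N) n′ ⟩
    (F m ∗ 𝟏) N + ∑[ j < n′ ] (F m ∗ F m ∗^ suc j) N
      ≡⟨ cong₂ _+_ (∗-identityʳ (F m) N) (sym (∗-distribˡ-∑ (F m) (λ j → F m ∗^ suc j) n′ N)) ⟩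
    F m N + (F m ∗ (λ t → ∑[ j < n′ ] (F m ∗^ suc j) t)) N
      ≡⟨ cong (F m N +_) (∗-congʳ-< (F m) refl (λ t t<N → truncated t t<N)) ⟩
    F m N + (F m ∗ F (suc m)) N
      ≡⟨ cong (F m N +_) (*-identityˡ _) ⟨
    F m N + 1 * (F m ∗ F (suc m)) N ∎
    where
    truncated : ∀ t → t < N → ∑[ j < n′ ] (F m ∗^ suc j) t ≡ F (suc m) t
    truncated zero     _           = ∑<-zero n′ (λ j _ → ∗^-vanish {F m} refl {suc j} (s≤s z≤n))
    truncated (suc t) (s≤s t<n′) = begin
      ∑[ j < n′ ] (F m ∗^ suc j) (suc t)
        ≡⟨ ∑<-vanishing-tail (λ j → (F m ∗^ suc j) (suc t)) t<n′ (λ j t<j → ∗^-vanish {F m} refl (s≤s t<j)) ⟩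
      ∑[ j < suc t ] (F m ∗^ suc j) (suc t)
        ≡⟨ fIter-suc m (suc t) ⟨
      F (suc m) (suc t) ∎

  gf-fIter : ∀ m → F m ≈ geometric m
  gf-fIter zero    n = sym (geometric-zero n)
  gf-fIter (suc m)   = fixpoint-unique (geometric m) (geometric m) 1 refl F-fix (geometric-suc m)
    where
    F-fix : F (suc m) ≈ geometric m ⊕ 1 · (geometric m ∗ F (suc m))
    F-fix n = trans (gf-fIter-suc m n)
      (cong₂ (λ p q → p + 1 * q) (gf-fIter m n) (∗-congˡ (F (suc m)) (gf-fIter m) n))

  fIter-closedForm : ∀ m n → 1 ≤ n → fIter f₀ m n ≡ ∑[ j < n ] (m ^ j * (gf f₀ ∗^ suc j) n)
  fIter-closedForm m (suc n) _ = gf-fIter m (suc n)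

  compSum-closedForm : ∀ m k n →
    compSum (fIter f₀ m) n (suc k) ≡ ∑[ j < n ] (m ^ (j ∸ k) * (j C k) * (gf f₀ ∗^ suc j) n)
  compSum-closedForm m k n = begin
    compSum (fIter f₀ m) n (suc k)     ≡⟨ compSum≡gf∗^ (fIter f₀ m) (suc k) n ⟩
    (F m ∗^ suc k) n                   ≡⟨ ∗^-cong (gf-fIter m) (suc k) n ⟩
    (geometric m ∗^ suc k) n           ≡⟨ geometric-power m k n ⟩
    powerSum (binomialWeight m k) n    ∎

ones : Series
ones _ = 1

ones-∗^ : ∀ s r → (ones ∗^ suc s) r ≡ (r + s) C s
ones-∗^ zero    r       = ∗-identityʳ ones r
ones-∗^ (suc s) zero    = trans (*-identityˡ _) (trans (ones-∗^ s 0) (trans (nCn≡1 s) (sym (nCn≡1 (suc s)))))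
ones-∗^ (suc s) (suc r) = begin
  (ones ∗ ones ∗^ suc s) (suc r)
    ≡⟨ ∗-sucˡ ones (ones ∗^ suc s) r ⟩
  1 * (ones ∗^ suc s) (suc r) + (ones ∗^ suc (suc s)) r
    ≡⟨ cong₂ _+_ (trans (*-identityˡ _) (ones-∗^ s (suc r))) (ones-∗^ (suc s) r) ⟩
  suc (r + s) C s + (r + suc s) C suc s
    ≡⟨ cong (λ t → suc (r + s) C s + t C suc s) (+-suc r s) ⟩
  suc (r + s) C s + suc (r + s) C suc s
    ≡⟨ nCk+nC[k+1]≡[n+1]C[k+1] (suc (r + s)) s ⟩
  suc (suc (r + s)) C suc s
    ≡⟨ cong (λ t → suc t C suc s) (+-suc r s) ⟨
  (suc r + suc s) C suc s ∎

gf-f0 : ∀ a′ → gf (f0 (suc a′)) ≈ shift (ones ∗^ suc a′)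
gf-f0 a′ zero    = refl
gf-f0 a′ (suc n) = trans (cong (λ t → (t ∸ 1) C a′) (+-suc n a′)) (sym (ones-∗^ a′ n))

gf-f0-∗^ : ∀ a′ {j n} → j < n →
  (gf (f0 (suc a′)) ∗^ suc j) n ≡ (n + suc a′ * suc j ∸ suc j ∸ 1) C (suc a′ * suc j ∸ 1)
gf-f0-∗^ a′ {j} {n} j<n =
  subst (λ n → (g ∗^ suc j) n ≡ (n + a * suc j ∸ suc j ∸ 1) C s) (m+[n∸m]≡n j<n) (at (n ∸ suc j))
  where
  a s : ℕ
  a = suc a′
  s = j + a′ * suc j
  g : Series
  g = gf (f0 a)
  at : ∀ r → (g ∗^ suc j) (suc j + r) ≡ (suc j + r + a * suc j ∸ suc j ∸ 1) C s
  at r = begin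
    (g ∗^ suc j) (suc j + r)
      ≡⟨ ∗^-cong (gf-f0 a′) (suc j) (suc j + r) ⟩
    (shift (ones ∗^ a) ∗^ suc j) (suc j + r)
      ≡⟨ shift-∗^ (ones ∗^ a) (suc j) (suc j + r) ⟩
    shift^ (suc j) ((ones ∗^ a) ∗^ suc j) (suc j + r)
      ≡⟨ shift^-+ (suc j) ((ones ∗^ a) ∗^ suc j) r ⟩
    ((ones ∗^ a) ∗^ suc j) r
      ≡⟨ ∗^-* ones a (suc j) r ⟩
    (ones ∗^ suc s) r
      ≡⟨ ones-∗^ s r ⟩
    (r + s) C s
      ≡⟨ cong (_C s) index ⟨
    (suc j + r + suc s ∸ suc j ∸ 1) C s ∎
    where
    index : suc j + r + suc s ∸ suc j ∸ 1 ≡ r + s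
    index = begin
      suc j + r + suc s ∸ suc j ∸ 1    ≡⟨ cong (λ t → t ∸ suc j ∸ 1) (+-assoc (suc j) r (suc s)) ⟩
      suc j + (r + suc s) ∸ suc j ∸ 1  ≡⟨ cong (_∸ 1) (m+n∸m≡n (suc j) (r + suc s)) ⟩
      r + suc s ∸ 1                    ≡⟨ cong (_∸ 1) (+-suc r s) ⟩
      r + s                            ∎

fIter-f0 : ∀ a′ m n → 1 ≤ n →
  fIter (f0 (suc a′)) m n ≡ Σ[ 1 ≤ (λ i → (m ^ (i ∸ 1)) * ((n + suc a′ * i ∸ i ∸ 1) C (suc a′ * i ∸ 1))) ≤ n ]
fIter-f0 a′ m n 1≤n = begin
  fIter (f0 (suc a′)) m n
    ≡⟨ fIter-closedForm (f0 (suc a′)) m n 1≤n ⟩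
  ∑[ j < n ] (m ^ j * (gf (f0 (suc a′)) ∗^ suc j) n)
    ≡⟨ ∑<-cong n (λ j j<n → cong (m ^ j *_) (gf-f0-∗^ a′ j<n)) ⟩
  ∑[ j < n ] (m ^ j * B (suc j))
    ≡⟨ Σ[]≡∑< (λ i → (m ^ (i ∸ 1)) * B i) 1 n ⟨
  Σ[ 1 ≤ (λ i → (m ^ (i ∸ 1)) * B i) ≤ n ] ∎
  where
  B : ℕ → ℕ
  B i = (n + suc a′ * i ∸ i ∸ 1) C (suc a′ * i ∸ 1)

cCoef-f0 : ∀ a′ m′ k′ {n} → suc k′ ≤ n →
  cCoef (f0 (suc a′)) (suc m′) n (suc k′)
    ≡ Σ[ suc k′ ≤ (λ i → (m′ ^ (i ∸ suc k′)) * ((i ∸ 1) C k′) * ((n + suc a′ * i ∸ i ∸ 1) C (suc a′ * i ∸ 1))) ≤ n ]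
cCoef-f0 a′ m′ k′ {n} k<n = begin
  compSum (fIter (f0 (suc a′)) m′) n (suc k′)
    ≡⟨ compSum-closedForm (f0 (suc a′)) m′ k′ n ⟩
  ∑[ j < n ] (w j * (gf (f0 (suc a′)) ∗^ suc j) n)
    ≡⟨ ∑<-cong n (λ j j<n → cong (w j *_) (gf-f0-∗^ a′ j<n)) ⟩
  ∑[ j < n ] (w j * B (suc j))
    ≡⟨ ∑<-vanishing-head (λ j → w j * B (suc j)) (<⇒≤ k<n)
         (λ j j<k′ → cong (_* B (suc j)) (binomialWeight-below m′ j<k′)) ⟩
  ∑[ j < n ∸ k′ ] (w (k′ + j) * B (suc (k′ + j)))
    ≡⟨ Σ[]≡∑< (λ i → (m′ ^ (i ∸ suc k′)) * ((i ∸ 1) C k′) * B i) (suc k′) n ⟨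
  Σ[ suc k′ ≤ (λ i → (m′ ^ (i ∸ suc k′)) * ((i ∸ 1) C k′) * B i) ≤ n ] ∎
  where
  w : ℕ → ℕ
  w = binomialWeight m′ k′
  B : ℕ → ℕ
  B i = (n + suc a′ * i ∸ i ∸ 1) C (suc a′ * i ∸ 1)

mainTheorem10 : (a m : ℕ) → 1 ≤ a → 1 ≤ m →
    ((n k : ℕ) → 1 ≤ k → k ≤ n →
      cCoef (f0 a) m n k
        ≡ Σ[ k ≤ (λ i → ((m ∸ 1) ^ (i ∸ k)) * ((i ∸ 1) C (k ∸ 1)) * ((n + a * i ∸ i ∸ 1) C (a * i ∸ 1))) ≤ n ])
    × ((n : ℕ) → 1 ≤ n →
      fIter (f0 a) m n
        ≡ Σ[ 1 ≤ (λ i → (m ^ (i ∸ 1)) * ((n + a * i ∸ i ∸ 1) C (a * i ∸ 1))) ≤ n ])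
mainTheorem10 (suc a′) (suc m′) _ _ =
  (λ { n zero () _ ; n (suc k′) _ k≤n → cCoef-f0 a′ m′ k′ k≤n }) , fIter-f0 a′ (suc m′)
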